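{- For $\bm\ell=(\ell_1,\dots,\ell_{12})\in\mathbb Z^{12}$, an integer $n$ and a real number $x$, define $$C(\bm\ell,n,x)=\binom{n-1}{\ell_1+\lfloor x\rfloor}\binom{n-\ell_1-\lceil x\rceil}{\ell_3}\binom{n-1}{\ell_6+\lfloor x\rfloor}\binom{n-\ell_6-\lceil x\rceil}{\ell_4}.$$ Let $p$ be a prime and $s\ge1$ an integer such that $p^s$ divides every component of $\bm\ell$ and divides $n$, and let $x\in\mathbb R$ with $0\le x\le p^s$. Then $$C(\bm\ell,n,x)\equiv C(\bm\ell/p,\,n/p,\,x/p)\pmod{p^s}.$$
   Context: $\lfloor\cdot\rfloor$ and $\lceil\cdot\rceil$ are the floor and ceiling functions. For an integer $N$ and integer $j$, $\binom{N}{j}=N(N-1)\cdots(N-j+1)/j!$ if $j\ge0$ and $\binom{N}{j}=0$ if $j<0$.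
   Formalization: The number x ranges over the rationals in the interval $0\le x\le p^s$ rather than over the reals. -}

module Defs where

open import Data.Nat as ℕ using (ℕ; zero; suc; _!; NonZero)
open import Data.Nat.Properties using (_!≢0)
open import Data.Integer using (ℤ; +_; -[1+_]; _*_; _-_; _+_; _/ℕ_)
open import Data.Rational using (ℚ; floor; ceiling)
open import Data.Vec using (Vec; lookup)
open import Data.Fin using (Fin)

fall : ℤ → ℕ → ℤ
fall N zero    = + 1
fall N (suc j) = fall N j * (N - + j)

binom : ℤ → ℤ → ℤ
binom N (+ j)    = _/ℕ_ (fall N j) (j !) {{j !≢0}}
binom N -[1+ _ ] = + 0

C : Vec ℤ 12 → ℤ → ℚ → ℤ
C ℓ n x =
  binom (n - + 1) (l1 + floor x) * binom (n - l1 - ceiling x) l3 *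
  binom (n - + 1) (l6 + floor x) * binom (n - l6 - ceiling x) l4
  where
  l1 = lookup ℓ (Fin.zero)
  l3 = lookup ℓ (Fin.suc (Fin.suc Fin.zero))
  l4 = lookup ℓ (Fin.suc (Fin.suc (Fin.suc Fin.zero)))
  l6 = lookup ℓ (Fin.suc (Fin.suc (Fin.suc (Fin.suc (Fin.suc Fin.zero)))))

{-# OPTIONS --safe #-}
module Submission where

-- Write M (M-1) ⋯ (M-k+1) = U · p^c · ⌊M/p⌋ (⌊M/p⌋-1) ⋯ (⌊M/p⌋-c+1), where c is the number of
-- multiples of p among the k factors and U, the product of the other factors, is prime to p.
-- Comparing with M = -1, where binom(-1, k) = (-1)^k, shows: if M and -1 have the same c (which
-- is then ⌊k/p⌋) and unit products congruent modulo p^s, then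
--   binom(M, k) ≡ ε k · binom(⌊M/p⌋, ⌊k/p⌋)  (mod p^s),   ε k = (-1)^(k + ⌊k/p⌋).
-- This holds for M = n - 1 when p^s ∣ n, factor by factor, and for every M when p^s ∣ k,
-- because modulo p^s the unit product of p^s consecutive integers does not depend on where
-- they start. The latter case at M = k = p^s gives ε(p^s) ≡ 1, so ε is periodic modulo p^s.
-- In C the two factors binom(n - 1, ℓᵢ + ⌊x⌋) therefore carry the same sign ε, and ε² = 1,
-- while the other two factors carry the sign of a multiple of p^s, which is ≡ 1. Finally
-- ⌊x/p⌋ = ⌊⌊x⌋/p⌋ and ⌈x/p⌉ = -⌊⌊-x⌋/p⌋ turn the reduced indices into those of C(ℓ/p, n/p, x/p).

module BinomialCongruences where

  open import Data.Nat as ℕ using (ℕ; zero; suc; NonZero; _!)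
  import Data.Nat.Properties as ℕP
  import Data.Nat.Divisibility as ND
  open ND using () renaming (_∣_ to _∣ℕ_)
  import Data.Nat.DivMod as NDM
  open import Data.Nat.Primality using (Prime; euclidsLemma; prime⇒nonTrivial)
  import Data.Nat.Tactic.RingSolver as ℕSolver
  open import Data.Integer as ℤ
    using (ℤ; +_; -[1+_]; _+_; _-_; _*_; -_; _^_; _/ℕ_; _%ℕ_; _≤_; _<_; -1ℤ)
  import Data.Integer.Properties as ℤP
  open import Data.Integer.DivMod using (a≡a%ℕn+[a/ℕn]*n; n%ℕd<d; [n/ℕd]*d≤n; n<s[n/ℕd]*d)
  open import Data.Integer.Divisibility.Signed
    using (_∣_; divides; ∣-refl; ∣-trans; ∣m∣n⇒∣m+n; ∣m∣n⇒∣m-n; ∣m+n∣n⇒∣m; ∣m⇒∣-m;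
           ∣n⇒∣m*n; ∣m⇒∣m*n; *-monoʳ-∣; ∣ᵤ⇒∣; ∣⇒∣ᵤ)
  open import Data.Integer.Tactic.RingSolver using (solve-∀)
  import Data.Rational as ℚ
  import Data.Rational.Properties as ℚP
  open import Data.Vec using (_∷_; map)
  open import Data.Vec.Relation.Unary.All using (All; _∷_)
  open import Data.Product using (Σ; _,_)
  open import Data.Sum using (inj₁; inj₂)
  import Algebra.Properties.AbelianGroup
  open import Level using (0ℓ)
  open import Relation.Binary.Bundles using (Setoid)
  open import Relation.Binary.PropositionalEquality
  open import Relation.Nullary using (¬_; contradiction)
  open import Defs using (fall; binom; C)

  isZero : ℕ → ℕ
  isZero zero    = 1
  isZero (suc _) = 0

  module _ (d : ℕ) .{{_ : NonZero d}} where

    /ℕ-unique : ∀ a q r → r ℕ.< d → a ≡ + r + q * + d → a /ℕ d ≡ q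
    /ℕ-unique a q r r<d refl = ℤP.≤-antisym
      (quotient-≤ ([n/ℕd]*d≤n a d) a<[1+q]*d)
      (quotient-≤ (ℤP.i≤j+i _ (+ r)) (n<s[n/ℕd]*d a d))
      where
      a<[1+q]*d : a < ℤ.suc q * + d
      a<[1+q]*d = subst (a <_) (sym (ℤP.suc-* q (+ d))) (ℤP.+-monoˡ-< (q * + d) (ℤ.+<+ r<d))
      quotient-≤ : ∀ {q q′} → q * + d ≤ a → a < ℤ.suc q′ * + d → q ≤ q′
      quotient-≤ {q} {q′} lo hi = subst (q ≤_) (ℤP.pred-suc q′)
        (ℤP.i<j⇒i≤pred[j] {j = ℤ.suc q′} (ℤP.*-cancelʳ-<-nonNeg (+ d) (ℤP.≤-<-trans lo hi)))

    %ℕ-unique : ∀ a q r → r ℕ.< d → a ≡ + r + q * + d → a %ℕ d ≡ r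
    %ℕ-unique a q r r<d a≡ = ℤP.+-injective (+-cancelʳ (q * + d) _ _ (begin
      + (a %ℕ d) + q * + d       ≡⟨ cong (λ t → + (a %ℕ d) + t * + d) (/ℕ-unique a q r r<d a≡) ⟨
      + (a %ℕ d) + a /ℕ d * + d  ≡⟨ a≡a%ℕn+[a/ℕn]*n a d ⟨
      a                          ≡⟨ a≡ ⟩
      + r + q * + d              ∎))
      where
      open ≡-Reasoning
      open Algebra.Properties.AbelianGroup ℤP.+-0-abelianGroup using () renaming (∙-cancelʳ to +-cancelʳ)

    private
      a+q*d≡%+[/+q]*d : ∀ a q → a + q * + d ≡ + (a %ℕ d) + (a /ℕ d + q) * + d
      a+q*d≡%+[/+q]*d a q =
        trans (cong (_+ q * + d) (a≡a%ℕn+[a/ℕn]*n a d)) (regroup (+ (a %ℕ d)) (a /ℕ d) q (+ d))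
        where
        regroup : ∀ r q′ q d → r + q′ * d + q * d ≡ r + (q′ + q) * d
        regroup = solve-∀

    [a+q*d]/ℕd≡a/ℕd+q : ∀ a q → (a + q * + d) /ℕ d ≡ a /ℕ d + q
    [a+q*d]/ℕd≡a/ℕd+q a q = /ℕ-unique _ _ (a %ℕ d) (n%ℕd<d a d) (a+q*d≡%+[/+q]*d a q)

    [a+q*d]%ℕd≡a%ℕd : ∀ a q → (a + q * + d) %ℕ d ≡ a %ℕ d
    [a+q*d]%ℕd≡a%ℕd a q = %ℕ-unique _ (a /ℕ d + q) _ (n%ℕd<d a d) (a+q*d≡%+[/+q]*d a q)

    [q*d]/ℕd≡q : ∀ q → (q * + d) /ℕ d ≡ q
    [q*d]/ℕd≡q q = /ℕ-unique (q * + d) q 0 (ℕ.>-nonZero⁻¹ d) (sym (ℤP.+-identityˡ _))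

    [q*d]%ℕd≡0 : ∀ q → (q * + d) %ℕ d ≡ 0
    [q*d]%ℕd≡0 q = %ℕ-unique (q * + d) q 0 (ℕ.>-nonZero⁻¹ d) (sym (ℤP.+-identityˡ _))

    [-1-a]/ℕd≡-1-a/ℕd : ∀ a → (-1ℤ - a) /ℕ d ≡ -1ℤ - a /ℕ d
    [-1-a]/ℕd≡-1-a/ℕd a = /ℕ-unique (-1ℤ - a) (-1ℤ - a /ℕ d) e (ℕP.∸-monoʳ-< ℕ.z<s r<d) (begin
      -1ℤ - a                                    ≡⟨ cong (λ a → -1ℤ - a) (a≡a%ℕn+[a/ℕn]*n a d) ⟩
      -1ℤ - (+ r + a /ℕ d * + d)                 ≡⟨ cong (λ D → -1ℤ - (+ r + a /ℕ d * D)) d≡ ⟩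
      -1ℤ - (+ r + a /ℕ d * (+ 1 + + r + + e))   ≡⟨ complement (a /ℕ d) (+ r) (+ e) ⟩
      + e + (-1ℤ - a /ℕ d) * (+ 1 + + r + + e)   ≡⟨ cong (λ D → + e + (-1ℤ - a /ℕ d) * D) d≡ ⟨
      + e + (-1ℤ - a /ℕ d) * + d                 ∎)
      where
      open ≡-Reasoning
      r = a %ℕ d
      r<d = n%ℕd<d a d
      e = d ℕ.∸ suc r
      d≡ : + d ≡ + 1 + + r + + e
      d≡ = trans (cong +_ (sym (ℕP.m+[n∸m]≡n r<d))) (ℤP.pos-+ (suc r) e)
      complement : ∀ q r e → -1ℤ - (r + q * (+ 1 + r + e)) ≡ e + (-1ℤ - q) * (+ 1 + r + e)
      complement = solve-∀

    [a-1]/ℕd≡a/ℕd-1 : ∀ a → a %ℕ d ≡ 0 → (a - + 1) /ℕ d ≡ a /ℕ d - + 1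
    [a-1]/ℕd≡a/ℕd-1 a a%d≡0 =
      /ℕ-unique (a - + 1) (q - + 1) e (subst (e ℕ.<_) (ℕP.suc-pred d) ℕP.≤-refl) (begin
        a - + 1                           ≡⟨ cong (_- + 1) (a≡a%ℕn+[a/ℕn]*n a d) ⟩
        + (a %ℕ d) + q * + d - + 1        ≡⟨ cong (λ r → + r + q * + d - + 1) a%d≡0 ⟩
        + 0 + q * + d - + 1               ≡⟨ cong (λ D → + 0 + q * D - + 1) d≡ ⟩
        + 0 + q * (+ 1 + + e) - + 1       ≡⟨ borrow q (+ e) ⟩
        + e + (q - + 1) * (+ 1 + + e)     ≡⟨ cong (λ D → + e + (q - + 1) * D) d≡ ⟨
        + e + (q - + 1) * + d             ∎)
      where
      open ≡-Reasoning
      q = a /ℕ d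
      e = ℕ.pred d
      d≡ : + d ≡ + 1 + + e
      d≡ = cong +_ (sym (ℕP.suc-pred d))
      borrow : ∀ q e → + 0 + q * (+ 1 + e) - + 1 ≡ e + (q - + 1) * (+ 1 + e)
      borrow = solve-∀

    [a-1]/ℕd≡a/ℕd : ∀ a r → a %ℕ d ≡ suc r → (a - + 1) /ℕ d ≡ a /ℕ d
    [a-1]/ℕd≡a/ℕd a r a%d≡1+r =
      /ℕ-unique (a - + 1) (a /ℕ d) r (ℕP.<⇒≤ (subst (ℕ._< d) a%d≡1+r (n%ℕd<d a d))) (begin
        a - + 1                              ≡⟨ cong (_- + 1) (a≡a%ℕn+[a/ℕn]*n a d) ⟩
        + (a %ℕ d) + a /ℕ d * + d - + 1      ≡⟨ cong (λ r → + r + a /ℕ d * + d - + 1) a%d≡1+r ⟩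
        + 1 + + r + a /ℕ d * + d - + 1       ≡⟨ cancel (+ r) (a /ℕ d * + d) ⟩
        + r + a /ℕ d * + d                   ∎)
      where
      open ≡-Reasoning
      cancel : ∀ r x → + 1 + r + x - + 1 ≡ r + x
      cancel = solve-∀

    [a-1]/ℕd≡a/ℕd-isZero[a%ℕd] : ∀ a → (a - + 1) /ℕ d ≡ a /ℕ d - + isZero (a %ℕ d)
    [a-1]/ℕd≡a/ℕd-isZero[a%ℕd] a with a %ℕ d in a%d≡
    ... | zero  = [a-1]/ℕd≡a/ℕd-1 a a%d≡
    ... | suc r = trans ([a-1]/ℕd≡a/ℕd a r a%d≡) (sym (ℤP.+-identityʳ (a /ℕ d)))

    /ℕ-negative : ∀ n → Σ ℕ λ j → -[1+ n ] /ℕ d ≡ -[1+ j ]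
    /ℕ-negative n with -[1+ n ] /ℕ d in q≡
    ... | -[1+ j ] = j , refl
    ... | + q      = contradiction +[q*d]≤-[1+n] λ ()
      where
      +[q*d]≤-[1+n] : + (q ℕ.* d) ≤ -[1+ n ]
      +[q*d]≤-[1+n] = subst (_≤ -[1+ n ]) (trans (cong (_* + d) q≡) (sym (ℤP.pos-* q d))) ([n/ℕd]*d≤n -[1+ n ] d)

  module _ (d k : ℕ) .{{_ : NonZero d}} .{{_ : NonZero k}} where

    private instance _ = ℕP.m*n≢0 d k

    [a*k]/ℕ[d*k]≡a/ℕd : ∀ a → (a * + k) /ℕ (d ℕ.* k) ≡ a /ℕ d
    [a*k]/ℕ[d*k]≡a/ℕd a = /ℕ-unique (d ℕ.* k) (a * + k) (a /ℕ d) (r ℕ.* k) (ℕP.*-monoˡ-< k (n%ℕd<d a d))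
      (begin
        a * + k                               ≡⟨ cong (_* + k) (a≡a%ℕn+[a/ℕn]*n a d) ⟩
        (+ r + a /ℕ d * + d) * + k            ≡⟨ distribute (+ r) (a /ℕ d) (+ d) (+ k) ⟩
        + r * + k + a /ℕ d * (+ d * + k)      ≡⟨ cong₂ (λ x y → x + a /ℕ d * y) (ℤP.pos-* r k) (ℤP.pos-* d k) ⟨
        + (r ℕ.* k) + a /ℕ d * + (d ℕ.* k)    ∎)
      where
      open ≡-Reasoning
      r = a %ℕ d
      distribute : ∀ r q d k → (r + q * d) * k ≡ r * k + q * (d * k)
      distribute = solve-∀

    a/ℕ[d*k]≡a/ℕd/ℕk : ∀ a → a /ℕ (d ℕ.* k) ≡ a /ℕ d /ℕ k
    a/ℕ[d*k]≡a/ℕd/ℕk a = /ℕ-unique (d ℕ.* k) a q₂ (r ℕ.+ r₂ ℕ.* d) r+r₂d<dk (begin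
      a                                      ≡⟨ a≡a%ℕn+[a/ℕn]*n a d ⟩
      + r + q * + d                          ≡⟨ cong (λ x → + r + x * + d) (a≡a%ℕn+[a/ℕn]*n q k) ⟩
      + r + (+ r₂ + q₂ * + k) * + d          ≡⟨ regroup (+ r) (+ r₂) q₂ (+ d) (+ k) ⟩
      + r + + r₂ * + d + q₂ * (+ d * + k)
        ≡⟨ cong₂ (λ x y → + r + x + q₂ * y) (ℤP.pos-* r₂ d) (ℤP.pos-* d k) ⟨
      + (r ℕ.+ r₂ ℕ.* d) + q₂ * + (d ℕ.* k)  ∎)
      where
      open ≡-Reasoning
      r = a %ℕ d
      q = a /ℕ d
      r₂ = q %ℕ k
      q₂ = q /ℕ k
      r+r₂d<dk : r ℕ.+ r₂ ℕ.* d ℕ.< d ℕ.* k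
      r+r₂d<dk = ℕP.<-≤-trans (ℕP.+-monoˡ-< (r₂ ℕ.* d) (n%ℕd<d a d))
        (subst (d ℕ.+ r₂ ℕ.* d ℕ.≤_) (ℕP.*-comm k d) (ℕP.*-monoˡ-≤ d (n%ℕd<d q k)))
      regroup : ∀ r r₂ q₂ d k → r + (r₂ + q₂ * k) * d ≡ r + r₂ * d + q₂ * (d * k)
      regroup = solve-∀

  floor≡↥/ℕ↧ : ∀ x → ℚ.floor x ≡ ℚ.↥ x /ℕ ℚ.↧ₙ x
  floor≡↥/ℕ↧ (ℚ.mkℚ _ _ _) = ℤP.*-identityˡ _

  ceiling≡-floor[-x] : ∀ x → ℚ.ceiling x ≡ - ℚ.floor (ℚ.- x)
  ceiling≡-floor[-x] (ℚ.mkℚ _ _ _) = refl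

  floor-unnormalised : ∀ x g {N D} .{{_ : NonZero D}} →
    ℚ.↥ x * + g ≡ N → ℚ.↧ₙ x ℕ.* g ≡ D → ℚ.floor x ≡ N /ℕ D
  floor-unnormalised x g refl refl = begin
    ℚ.floor x                          ≡⟨ floor≡↥/ℕ↧ x ⟩
    ℚ.↥ x /ℕ ℚ.↧ₙ x                    ≡⟨ [a*k]/ℕ[d*k]≡a/ℕd (ℚ.↧ₙ x) g (ℚ.↥ x) ⟨
    (ℚ.↥ x * + g) /ℕ (ℚ.↧ₙ x ℕ.* g)    ∎
    where
    open ≡-Reasoning
    instance _ = ℕP.m*n≢0⇒n≢0 (ℚ.↧ₙ x)

  floor[x*1/n]≡floor[x]/ℕn : ∀ x n .{{_ : NonZero n}} → ℚ.floor (x ℚ.* (+ 1 ℚ./ n)) ≡ ℚ.floor x /ℕ n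
  floor[x*1/n]≡floor[x]/ℕn x n = via-normal-forms (ℚP.↥-* x w) (ℚP.↧-* x w) (ℚP.↥-/ (+ 1) n) (ℚP.↧-/ (+ 1) n)
    where
    w = + 1 ℚ./ n
    z = x ℚ.* w
    via-normal-forms : ∀ {g₁ g₂} →
      ℚ.↥ z * + g₁ ≡ ℚ.↥ x * ℚ.↥ w → ℚ.↧ z * + g₁ ≡ ℚ.↧ x * ℚ.↧ w →
      ℚ.↥ w * + g₂ ≡ + 1 → ℚ.↧ w * + g₂ ≡ + n → ℚ.floor z ≡ ℚ.floor x /ℕ n
    via-normal-forms {g₁} {g₂} ↥z≡ ↧z≡ ↥w≡ ↧w≡ = begin
      ℚ.floor z                   ≡⟨ floor-unnormalised z (g₁ ℕ.* g₂) ↥-unnormalised ↧-unnormalised ⟩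
      ℚ.↥ x /ℕ (ℚ.↧ₙ x ℕ.* n)     ≡⟨ a/ℕ[d*k]≡a/ℕd/ℕk (ℚ.↧ₙ x) n (ℚ.↥ x) ⟩
      ℚ.↥ x /ℕ ℚ.↧ₙ x /ℕ n        ≡⟨ cong (_/ℕ n) (floor≡↥/ℕ↧ x) ⟨
      ℚ.floor x /ℕ n              ∎
      where
      open ≡-Reasoning
      instance _ = ℕP.m*n≢0 (ℚ.↧ₙ x) n
      chain : ∀ a b c d → a * + g₁ ≡ b * c → c * + g₂ ≡ d → a * + (g₁ ℕ.* g₂) ≡ b * d
      chain a b c d a*g₁≡bc c*g₂≡d = begin
        a * + (g₁ ℕ.* g₂)      ≡⟨ cong (a *_) (ℤP.pos-* g₁ g₂) ⟩
        a * (+ g₁ * + g₂)      ≡⟨ ℤP.*-assoc a (+ g₁) (+ g₂) ⟨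
        a * + g₁ * + g₂        ≡⟨ cong (_* + g₂) a*g₁≡bc ⟩
        b * c * + g₂           ≡⟨ ℤP.*-assoc b c (+ g₂) ⟩
        b * (c * + g₂)         ≡⟨ cong (b *_) c*g₂≡d ⟩
        b * d                  ∎
      ↥-unnormalised : ℚ.↥ z * + (g₁ ℕ.* g₂) ≡ ℚ.↥ x
      ↥-unnormalised = trans (chain (ℚ.↥ z) (ℚ.↥ x) (ℚ.↥ w) (+ 1) ↥z≡ ↥w≡) (ℤP.*-identityʳ (ℚ.↥ x))
      ↧-unnormalised : ℚ.↧ₙ z ℕ.* (g₁ ℕ.* g₂) ≡ ℚ.↧ₙ x ℕ.* n
      ↧-unnormalised = ℤP.+-injective (begin
        + (ℚ.↧ₙ z ℕ.* (g₁ ℕ.* g₂))    ≡⟨ ℤP.pos-* (ℚ.↧ₙ z) _ ⟩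
        ℚ.↧ z * + (g₁ ℕ.* g₂)          ≡⟨ chain (ℚ.↧ z) (ℚ.↧ x) (ℚ.↧ w) (+ n) ↧z≡ ↧w≡ ⟩
        ℚ.↧ x * + n                    ≡⟨ ℤP.pos-* (ℚ.↧ₙ x) n ⟨
        + (ℚ.↧ₙ x ℕ.* n)               ∎)

  fall-suc′ : ∀ N k → fall (+ 1 + N) (suc k) ≡ (+ 1 + N) * fall N k
  fall-suc′ N zero    = unit N
    where
    unit : ∀ N → + 1 * (+ 1 + N - + 0) ≡ (+ 1 + N) * + 1
    unit = solve-∀
  fall-suc′ N (suc k) = begin
    fall (+ 1 + N) (suc k) * (+ 1 + N - + suc k)  ≡⟨ cong (_* (+ 1 + N - + suc k)) (fall-suc′ N k) ⟩
    (+ 1 + N) * fall N k * (+ 1 + N - + suc k)    ≡⟨ regroup N (fall N k) (+ k) ⟩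
    (+ 1 + N) * (fall N k * (N - + k))            ∎
    where
    open ≡-Reasoning
    regroup : ∀ N F k → (+ 1 + N) * F * (+ 1 + N - (+ 1 + k)) ≡ (+ 1 + N) * (F * (N - k))
    regroup = solve-∀

  fall-pascal : ∀ N k → fall (+ 1 + N) (suc k) ≡ fall N (suc k) + + suc k * fall N k
  fall-pascal N k = trans (fall-suc′ N k) (split N (fall N k) (+ k))
    where
    split : ∀ N F k → (+ 1 + N) * F ≡ F * (N - k) + (+ 1 + k) * F
    split = solve-∀

  k!∣fall : ∀ k N → + (k !) ∣ fall N k
  k!∣fall zero    N = ∣-refl
  k!∣fall (suc k) = all-N
    where
    [1+k]!∣[1+k]*fall : ∀ N → + (suc k !) ∣ + suc k * fall N k
    [1+k]!∣[1+k]*fall N =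
      subst (_∣ + suc k * fall N k) (sym (ℤP.pos-* (suc k) (k !))) (*-monoʳ-∣ (+ suc k) (k!∣fall k N))
    up : ∀ N → + (suc k !) ∣ fall N (suc k) → + (suc k !) ∣ fall (+ 1 + N) (suc k)
    up N h = subst (_ ∣_) (sym (fall-pascal N k)) (∣m∣n⇒∣m+n h ([1+k]!∣[1+k]*fall N))
    down : ∀ N → + (suc k !) ∣ fall (+ 1 + N) (suc k) → + (suc k !) ∣ fall N (suc k)
    down N h = ∣m+n∣n⇒∣m (subst (_ ∣_) (fall-pascal N k) h) ([1+k]!∣[1+k]*fall N)
    all-N : ∀ N → + (suc k !) ∣ fall N (suc k)
    all-N (+ zero)        = divides (+ 0) (fall-suc′ -1ℤ k)
    all-N (+ suc n)       = up (+ n) (all-N (+ n))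
    all-N -[1+ zero ]     = down -1ℤ (all-N (+ 0))
    all-N -[1+ suc n ]    = down -[1+ suc n ] (all-N -[1+ n ])

  fall≡x*k!⇒binom≡x : ∀ N k x → fall N k ≡ x * + (k !) → binom N (+ k) ≡ x
  fall≡x*k!⇒binom≡x N k x fall≡x*k! = trans (cong (λ F → F /ℕ (k !)) fall≡x*k!) ([q*d]/ℕd≡q (k !) x)
    where instance _ = k ℕP.!≢0

  binom*k!≡fall : ∀ N k → binom N (+ k) * + (k !) ≡ fall N k
  binom*k!≡fall N k with k!∣fall k N
  ... | divides t fall≡t*k! = trans (cong (_* + (k !)) (fall≡x*k!⇒binom≡x N k t fall≡t*k!)) (sym fall≡t*k!)

  fall[-1,k]≡-1^k*k! : ∀ k → fall -1ℤ k ≡ -1ℤ ^ k * + (k !)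
  fall[-1,k]≡-1^k*k! zero    = refl
  fall[-1,k]≡-1^k*k! (suc k) = begin
    fall -1ℤ k * (-1ℤ - + k)                  ≡⟨ cong (_* (-1ℤ - + k)) (fall[-1,k]≡-1^k*k! k) ⟩
    -1ℤ ^ k * + (k !) * (-1ℤ - + k)           ≡⟨ regroup (-1ℤ ^ k) (+ (k !)) (+ k) ⟩
    -1ℤ * -1ℤ ^ k * ((+ 1 + + k) * + (k !))   ≡⟨ cong (-1ℤ * -1ℤ ^ k *_) (ℤP.pos-* (suc k) (k !)) ⟨
    -1ℤ ^ suc k * + (suc k !)                 ∎
    where
    open ≡-Reasoning
    regroup : ∀ s f k → s * f * (-1ℤ - k) ≡ -1ℤ * s * ((+ 1 + k) * f)
    regroup = solve-∀

  binom[-1,k]≡-1^k : ∀ k → binom -1ℤ (+ k) ≡ -1ℤ ^ k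
  binom[-1,k]≡-1^k k = fall≡x*k!⇒binom≡x -1ℤ k (-1ℤ ^ k) (fall[-1,k]≡-1^k*k! k)

  fall[n,n]≡n! : ∀ n → fall (+ n) n ≡ + (n !)
  fall[n,n]≡n! zero    = refl
  fall[n,n]≡n! (suc n) = begin
    fall (+ 1 + + n) (suc n)    ≡⟨ fall-suc′ (+ n) n ⟩
    + suc n * fall (+ n) n      ≡⟨ cong (+ suc n *_) (fall[n,n]≡n! n) ⟩
    + suc n * + (n !)           ≡⟨ ℤP.pos-* (suc n) (n !) ⟨
    + (suc n !)                 ∎
    where open ≡-Reasoning

  binom[n,n]≡1 : ∀ n → binom (+ n) (+ n) ≡ + 1
  binom[n,n]≡1 n = fall≡x*k!⇒binom≡x (+ n) n (+ 1) (trans (fall[n,n]≡n! n) (sym (ℤP.*-identityˡ (+ (n !)))))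

  -1^n*-1^n≡1 : ∀ n → -1ℤ ^ n * -1ℤ ^ n ≡ + 1
  -1^n*-1^n≡1 zero    = refl
  -1^n*-1^n≡1 (suc n) = trans (square (-1ℤ ^ n)) (-1^n*-1^n≡1 n)
    where
    square : ∀ s → -1ℤ * s * (-1ℤ * s) ≡ s * s
    square = solve-∀

  +k′-+k≡j*m⇒k′≡k+j*m : ∀ k k′ j m → + k′ - + k ≡ + j * + m → k′ ≡ k ℕ.+ j ℕ.* m
  +k′-+k≡j*m⇒k′≡k+j*m k k′ j m k′-k≡ = ℤP.+-injective (begin
    + k′                 ≡⟨ split (+ k′) (+ k) ⟩
    + k + (+ k′ - + k)   ≡⟨ cong (_+_ (+ k)) (trans k′-k≡ (sym (ℤP.pos-* j m))) ⟩
    + k + + (j ℕ.* m)    ≡⟨ ℤP.pos-+ k (j ℕ.* m) ⟨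
    + (k ℕ.+ j ℕ.* m)    ∎)
    where
    open ≡-Reasoning
    split : ∀ a b → a ≡ b + (a - b)
    split = solve-∀

  -- A record rather than a synonym for + m ∣ a - b, so that a and b can be inferred from the type.
  infix 4 _≡_mod_
  record _≡_mod_ (a b : ℤ) (m : ℕ) : Set where
    constructor mod-divides
    field m∣a-b : + m ∣ a - b

  module _ {m : ℕ} where

    ≡-mod-reflexive : ∀ {a b} → a ≡ b → a ≡ b mod m
    ≡-mod-reflexive {a} refl = mod-divides (divides (+ 0) (ℤP.+-inverseʳ a))

    ≡-mod-sym : ∀ {a b} → a ≡ b mod m → b ≡ a mod m
    ≡-mod-sym {a} {b} (mod-divides m∣a-b) = mod-divides (subst (+ m ∣_) (negate a b) (∣m⇒∣-m m∣a-b))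
      where
      negate : ∀ a b → - (a - b) ≡ b - a
      negate = solve-∀

    ≡-mod-trans : ∀ {a b c} → a ≡ b mod m → b ≡ c mod m → a ≡ c mod m
    ≡-mod-trans {a} {b} {c} (mod-divides m∣a-b) (mod-divides m∣b-c) =
      mod-divides (subst (+ m ∣_) (ℤP.+-minus-telescope a b c) (∣m∣n⇒∣m+n m∣a-b m∣b-c))

    *-cong-mod : ∀ {a b c d} → a ≡ b mod m → c ≡ d mod m → a * c ≡ b * d mod m
    *-cong-mod {a} {b} {c} {d} (mod-divides m∣a-b) (mod-divides m∣c-d) =
      mod-divides (subst (+ m ∣_) (expand a b c d) (∣m∣n⇒∣m+n (∣n⇒∣m*n a m∣c-d) (∣m⇒∣m*n d m∣a-b)))
      where
      expand : ∀ a b c d → a * (c - d) + (a - b) * d ≡ a * c - b * d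
      expand = solve-∀

    *-congˡ-mod : ∀ a {b c} → b ≡ c mod m → a * b ≡ a * c mod m
    *-congˡ-mod a = *-cong-mod (≡-mod-reflexive {a} refl)

    *-congʳ-mod : ∀ {a b} c → a ≡ b mod m → a * c ≡ b * c mod m
    *-congʳ-mod c a≡b = *-cong-mod a≡b (≡-mod-reflexive {c} refl)

    -ʳ-cong-mod : ∀ {a b} c → a ≡ b mod m → a - c ≡ b - c mod m
    -ʳ-cong-mod {a} {b} c (mod-divides m∣a-b) = mod-divides (subst (+ m ∣_) (cancel a b c) m∣a-b)
      where
      cancel : ∀ a b c → a - b ≡ (a - c) - (b - c)
      cancel = solve-∀

  mod-setoid : ℕ → Setoid 0ℓ 0ℓ
  mod-setoid m = record
    { Carrier       = ℤ
    ; _≈_           = λ a b → a ≡ b mod m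
    ; isEquivalence = record
      { refl  = ≡-mod-reflexive refl
      ; sym   = ≡-mod-sym
      ; trans = ≡-mod-trans
      }
    }

  oneIfZero : ℕ → ℤ → ℤ
  oneIfZero zero    _ = + 1
  oneIfZero (suc _) a = a

  module _ (p : ℕ) .{{_ : NonZero p}} where

    unitFactor : ℤ → ℤ
    unitFactor a = oneIfZero (a %ℕ p) a

    #multiples : ℤ → ℕ → ℕ
    #multiples M zero    = 0
    #multiples M (suc k) = isZero ((M - + k) %ℕ p) ℕ.+ #multiples M k

    unitProduct : ℤ → ℕ → ℤ
    unitProduct M zero    = + 1
    unitProduct M (suc k) = unitProduct M k * unitFactor (M - + k)

    #multiples≡ : ∀ M k → + #multiples M k ≡ M /ℕ p - (M - + k) /ℕ p
    #multiples≡ M zero =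
      sym (trans (cong (λ a → M /ℕ p - a /ℕ p) (ℤP.+-identityʳ M)) (ℤP.+-inverseʳ (M /ℕ p)))
    #multiples≡ M (suc k) = begin
      + (isZero r ℕ.+ #multiples M k)           ≡⟨ ℤP.pos-+ (isZero r) _ ⟩
      + isZero r + + #multiples M k             ≡⟨ cong (λ c → + isZero r + c) (#multiples≡ M k) ⟩
      + isZero r + (M /ℕ p - (M - + k) /ℕ p)    ≡⟨ rearrange (+ isZero r) (M /ℕ p) ((M - + k) /ℕ p) ⟩
      M /ℕ p - ((M - + k) /ℕ p - + isZero r)
        ≡⟨ cong (λ q → M /ℕ p - q) ([a-1]/ℕd≡a/ℕd-isZero[a%ℕd] p (M - + k)) ⟨
      M /ℕ p - (M - + k - + 1) /ℕ p             ≡⟨ cong (λ a → M /ℕ p - a /ℕ p) (step M (+ k)) ⟩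
      M /ℕ p - (M - + suc k) /ℕ p               ∎
      where
      open ≡-Reasoning
      r = (M - + k) %ℕ p
      rearrange : ∀ z a b → z + (a - b) ≡ a - (b - z)
      rearrange = solve-∀
      step : ∀ M k → M - k - + 1 ≡ M - (+ 1 + k)
      step = solve-∀

    fall≡unitProduct*p^#multiples*fall : ∀ M k →
      fall M k ≡ unitProduct M k * (+ p) ^ #multiples M k * fall (M /ℕ p) (#multiples M k)
    fall≡unitProduct*p^#multiples*fall M zero = refl
    fall≡unitProduct*p^#multiples*fall M (suc k) with (M - + k) %ℕ p in r≡
    ... | zero  = begin
      fall M k * (M - + k)                         ≡⟨ cong₂ _*_ (fall≡unitProduct*p^#multiples*fall M k) M-k≡ ⟩
      U * P * F * ((M /ℕ p - + c) * + p)           ≡⟨ regroup U P F (M /ℕ p - + c) (+ p) ⟩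
      U * + 1 * (+ p * P) * (F * (M /ℕ p - + c))   ∎
      where
      open ≡-Reasoning
      c = #multiples M k
      U = unitProduct M k
      P = (+ p) ^ c
      F = fall (M /ℕ p) c
      M-k≡ : M - + k ≡ (M /ℕ p - + c) * + p
      M-k≡ = begin
        M - + k                                      ≡⟨ a≡a%ℕn+[a/ℕn]*n (M - + k) p ⟩
        + ((M - + k) %ℕ p) + (M - + k) /ℕ p * + p    ≡⟨ cong (λ r → + r + (M - + k) /ℕ p * + p) r≡ ⟩
        + 0 + (M - + k) /ℕ p * + p                   ≡⟨ ℤP.+-identityˡ _ ⟩
        (M - + k) /ℕ p * + p                         ≡⟨ cong (_* + p) (difference (M /ℕ p) _) ⟩
        (M /ℕ p - (M /ℕ p - (M - + k) /ℕ p)) * + p   ≡⟨ cong (λ c → (M /ℕ p - c) * + p) (#multiples≡ M k) ⟨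
        (M /ℕ p - + c) * + p                         ∎
        where
        difference : ∀ a b → b ≡ a - (a - b)
        difference = solve-∀
      regroup : ∀ U P F X p → U * P * F * (X * p) ≡ U * + 1 * (p * P) * (F * X)
      regroup = solve-∀
    ... | suc _ = trans (cong (_* (M - + k)) (fall≡unitProduct*p^#multiples*fall M k))
      (regroup (unitProduct M k) ((+ p) ^ #multiples M k) (fall (M /ℕ p) (#multiples M k)) (M - + k))
      where
      regroup : ∀ U P F a → U * P * F * a ≡ U * a * P * F
      regroup = solve-∀

    binom*k!≡unitProduct*p^#multiples*binom*c! : ∀ M k → let c = #multiples M k in
      binom M (+ k) * + (k !) ≡ unitProduct M k * (+ p) ^ c * (binom (M /ℕ p) (+ c) * + (c !))
    binom*k!≡unitProduct*p^#multiples*binom*c! M k = begin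
      binom M (+ k) * + (k !)                          ≡⟨ binom*k!≡fall M k ⟩
      fall M k                                         ≡⟨ fall≡unitProduct*p^#multiples*fall M k ⟩
      U * (+ p) ^ c * fall (M /ℕ p) c                  ≡⟨ cong (U * (+ p) ^ c *_) (binom*k!≡fall (M /ℕ p) c) ⟨
      U * (+ p) ^ c * (binom (M /ℕ p) (+ c) * + (c !)) ∎
      where
      open ≡-Reasoning
      c = #multiples M k
      U = unitProduct M k

    -- Multiplied by k! · p^c · c!, both sides become U · U′ · p^(2c) · (b · c!) · (b′ · c!).
    binom-cross : ∀ M M′ k → #multiples M k ≡ #multiples M′ k → let c = #multiples M k in
      unitProduct M′ k * binom M (+ k) * binom (M′ /ℕ p) (+ c) ≡
      unitProduct M k * binom M′ (+ k) * binom (M /ℕ p) (+ c)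
    binom-cross M M′ k c≡c′ = ℤP.*-cancelʳ-≡ _ _ K (begin
      U′ * B * b′ * K                              ≡⟨ regroup U′ B b′ (+ (k !)) P (+ (c !)) ⟩
      U′ * (B * + (k !)) * (b′ * + (c !)) * P      ≡⟨ cong (λ x → U′ * x * (b′ * + (c !)) * P) (expand M refl) ⟩
      U′ * (U * P * (b * + (c !))) * (b′ * + (c !)) * P
        ≡⟨ swap U U′ P (b * + (c !)) (b′ * + (c !)) ⟩
      U * (U′ * P * (b′ * + (c !))) * (b * + (c !)) * P
        ≡⟨ cong (λ x → U * x * (b * + (c !)) * P) (expand M′ (sym c≡c′)) ⟨
      U * (B′ * + (k !)) * (b * + (c !)) * P       ≡⟨ regroup U B′ b (+ (k !)) P (+ (c !)) ⟨
      U * B′ * b * K                               ∎)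
      where
      open ≡-Reasoning
      c = #multiples M k
      U = unitProduct M k
      U′ = unitProduct M′ k
      B = binom M (+ k)
      B′ = binom M′ (+ k)
      b = binom (M /ℕ p) (+ c)
      b′ = binom (M′ /ℕ p) (+ c)
      P = (+ p) ^ c
      K = + (k !) * (P * + (c !))
      expand : ∀ N → #multiples N k ≡ c →
        binom N (+ k) * + (k !) ≡ unitProduct N k * P * (binom (N /ℕ p) (+ c) * + (c !))
      expand N c≡ = subst
        (λ c → binom N (+ k) * + (k !) ≡ unitProduct N k * (+ p) ^ c * (binom (N /ℕ p) (+ c) * + (c !)))
        c≡ (binom*k!≡unitProduct*p^#multiples*binom*c! N k)
      regroup : ∀ u x y f P g → u * x * y * (f * (P * g)) ≡ u * (x * f) * (y * g) * P
      regroup = solve-∀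
      swap : ∀ u u′ P x y → u′ * (u * P * x) * y * P ≡ u * (u′ * P * y) * x * P
      swap = solve-∀
      instance
        _ = k ℕP.!≢0
        _ = c ℕP.!≢0
        p^c≢0 : ℤ.NonZero P
        p^c≢0 = ℤ.≢-nonZero (λ P≡0 → ℕ.≢-nonZero⁻¹ p (ℤP.+-injective (ℤP.i^n≡0⇒i≡0 (+ p) c P≡0)))
        _ = ℤP.i*j≢0 P (+ (c !))
        _ = ℤP.i*j≢0 (+ (k !)) (P * + (c !))

    ≡-mod-p*m⇒%ℕ≡ : ∀ {m a b} → a ≡ b mod (p ℕ.* m) → a %ℕ p ≡ b %ℕ p
    ≡-mod-p*m⇒%ℕ≡ {m} {a} {b} (mod-divides (divides t a-b≡t*pm)) = begin
      a %ℕ p                         ≡⟨ cong (_%ℕ p) a≡b+tm*p ⟩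
      (b + t * + m * + p) %ℕ p       ≡⟨ [a+q*d]%ℕd≡a%ℕd p b (t * + m) ⟩
      b %ℕ p                         ∎
      where
      open ≡-Reasoning
      a≡b+tm*p : a ≡ b + t * + m * + p
      a≡b+tm*p = begin
        a                     ≡⟨ split a b ⟩
        b + (a - b)           ≡⟨ cong (_+_ b) (trans a-b≡t*pm (cong (t *_) (ℤP.pos-* p m))) ⟩
        b + t * (+ p * + m)   ≡⟨ reassociate b t (+ p) (+ m) ⟩
        b + t * + m * + p     ∎
        where
        split : ∀ a b → a ≡ b + (a - b)
        split = solve-∀
        reassociate : ∀ b t p m → b + t * (p * m) ≡ b + t * m * p
        reassociate = solve-∀

    module _ {m : ℕ} where

      unitFactor-cong : ∀ {a b} → a ≡ b mod (p ℕ.* m) → unitFactor a ≡ unitFactor b mod (p ℕ.* m)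
      unitFactor-cong {a} {b} a≡b = subst (λ r → oneIfZero r a ≡ unitFactor b mod (p ℕ.* m))
        (sym (≡-mod-p*m⇒%ℕ≡ a≡b)) (same-residue (b %ℕ p))
        where
        same-residue : ∀ r → oneIfZero r a ≡ oneIfZero r b mod (p ℕ.* m)
        same-residue zero    = ≡-mod-reflexive refl
        same-residue (suc _) = a≡b

      unitProduct-cong : ∀ {M M′} k → M ≡ M′ mod (p ℕ.* m) →
        unitProduct M k ≡ unitProduct M′ k mod (p ℕ.* m)
      unitProduct-cong zero    M≡M′ = ≡-mod-reflexive refl
      unitProduct-cong (suc k) M≡M′ =
        *-cong-mod (unitProduct-cong k M≡M′) (unitFactor-cong (-ʳ-cong-mod (+ k) M≡M′))

      #multiples-cong : ∀ {M M′} k → M ≡ M′ mod (p ℕ.* m) → #multiples M k ≡ #multiples M′ k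
      #multiples-cong zero    M≡M′ = refl
      #multiples-cong (suc k) M≡M′ = cong₂ (λ r c → isZero r ℕ.+ c)
        (≡-mod-p*m⇒%ℕ≡ (-ʳ-cong-mod (+ k) M≡M′)) (#multiples-cong k M≡M′)

    unitProduct-+ : ∀ M a b → unitProduct M (a ℕ.+ b) ≡ unitProduct M a * unitProduct (M - + a) b
    unitProduct-+ M a zero    = trans (cong (unitProduct M) (ℕP.+-identityʳ a)) (sym (ℤP.*-identityʳ _))
    unitProduct-+ M a (suc b) = begin
      unitProduct M (a ℕ.+ suc b)                               ≡⟨ cong (unitProduct M) (ℕP.+-suc a b) ⟩
      unitProduct M (a ℕ.+ b) * unitFactor (M - + (a ℕ.+ b))
        ≡⟨ cong₂ _*_ (unitProduct-+ M a b) (cong unitFactor M-[a+b]≡) ⟩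
      unitProduct M a * unitProduct (M - + a) b * unitFactor (M - + a - + b)
        ≡⟨ ℤP.*-assoc (unitProduct M a) _ _ ⟩
      unitProduct M a * (unitProduct (M - + a) b * unitFactor (M - + a - + b)) ∎
      where
      open ≡-Reasoning
      M-[a+b]≡ : M - + (a ℕ.+ b) ≡ M - + a - + b
      M-[a+b]≡ = trans (cong (λ x → M - x) (ℤP.pos-+ a b)) (regroup M (+ a) (+ b))
        where
        regroup : ∀ M a b → M - (a + b) ≡ M - a - b
        regroup = solve-∀

    -1/ℕp≡-1 : -1ℤ /ℕ p ≡ -1ℤ
    -1/ℕp≡-1 = trans ([-1-a]/ℕd≡-1-a/ℕd p (+ 0)) (cong (λ q → -1ℤ - q) ([q*d]/ℕd≡q p (+ 0)))

    #multiples[-1,k]≡k/p : ∀ k → #multiples -1ℤ k ≡ k ℕ./ p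
    #multiples[-1,k]≡k/p k = ℤP.+-injective (begin
      + #multiples -1ℤ k              ≡⟨ #multiples≡ -1ℤ k ⟩
      -1ℤ /ℕ p - (-1ℤ - + k) /ℕ p     ≡⟨ cong₂ _-_ -1/ℕp≡-1 ([-1-a]/ℕd≡-1-a/ℕd p (+ k)) ⟩
      -1ℤ - (-1ℤ - + (k ℕ./ p))       ≡⟨ cancel (+ (k ℕ./ p)) ⟩
      + (k ℕ./ p)                     ∎)
      where
      open ≡-Reasoning
      cancel : ∀ q → -1ℤ - (-1ℤ - q) ≡ q
      cancel = solve-∀

    #multiples-of-multiple : ∀ M k → p ∣ℕ k → #multiples M k ≡ k ℕ./ p
    #multiples-of-multiple M .(q ℕ.* p) (ND.divides q refl) = ℤP.+-injective (begin
      + #multiples M (q ℕ.* p)          ≡⟨ #multiples≡ M (q ℕ.* p) ⟩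
      M /ℕ p - (M - + (q ℕ.* p)) /ℕ p   ≡⟨ cong (λ x → M /ℕ p - x /ℕ p) M-qp≡ ⟩
      M /ℕ p - (M + - + q * + p) /ℕ p   ≡⟨ cong (λ x → M /ℕ p - x) ([a+q*d]/ℕd≡a/ℕd+q p M (- + q)) ⟩
      M /ℕ p - (M /ℕ p + - + q)         ≡⟨ cancel (M /ℕ p) (+ q) ⟩
      + q                               ≡⟨ cong +_ (NDM.m*n/n≡m q p) ⟨
      + (q ℕ.* p ℕ./ p)                 ∎)
      where
      open ≡-Reasoning
      M-qp≡ : M - + (q ℕ.* p) ≡ M + - + q * + p
      M-qp≡ = cong (_+_ M) (trans (cong -_ (ℤP.pos-* q p)) (ℤP.neg-distribˡ-* (+ q) (+ p)))
      cancel : ∀ a b → a - (a + - b) ≡ b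
      cancel = solve-∀

    ε : ℕ → ℤ
    ε k = -1ℤ ^ (k ℕ.+ k ℕ./ p)

    ε-+ : ∀ k {m} → p ∣ℕ m → ε (k ℕ.+ m) ≡ ε k * ε m
    ε-+ k {m} p∣m = begin
      -1ℤ ^ (k ℕ.+ m ℕ.+ (k ℕ.+ m) ℕ./ p)
        ≡⟨ cong (λ x → -1ℤ ^ (k ℕ.+ m ℕ.+ x)) (NDM.+-distrib-/-∣ʳ k p∣m) ⟩
      -1ℤ ^ (k ℕ.+ m ℕ.+ (k ℕ./ p ℕ.+ m ℕ./ p))
        ≡⟨ cong (-1ℤ ^_) (interleave k m (k ℕ./ p) (m ℕ./ p)) ⟩
      -1ℤ ^ (k ℕ.+ k ℕ./ p ℕ.+ (m ℕ.+ m ℕ./ p))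
        ≡⟨ ℤP.^-distribˡ-+-* -1ℤ (k ℕ.+ k ℕ./ p) (m ℕ.+ m ℕ./ p) ⟩
      ε k * ε m
        ∎
      where
      open ≡-Reasoning
      interleave : ∀ k m a b → k ℕ.+ m ℕ.+ (a ℕ.+ b) ≡ k ℕ.+ a ℕ.+ (m ℕ.+ b)
      interleave = ℕSolver.solve-∀

    ε0≡1 : ε 0 ≡ + 1
    ε0≡1 = cong (-1ℤ ^_) (NDM.0/n≡0 p)

    [l+a]/ℕp≡l/ℕp+a/ℕp : ∀ l a → + p ∣ l → (l + a) /ℕ p ≡ l /ℕ p + a /ℕ p
    [l+a]/ℕp≡l/ℕp+a/ℕp .(q * + p) a (divides q refl) = begin
      (q * + p + a) /ℕ p       ≡⟨ cong (_/ℕ p) (ℤP.+-comm (q * + p) a) ⟩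
      (a + q * + p) /ℕ p       ≡⟨ [a+q*d]/ℕd≡a/ℕd+q p a q ⟩
      a /ℕ p + q               ≡⟨ ℤP.+-comm (a /ℕ p) q ⟩
      q + a /ℕ p               ≡⟨ cong (_+ a /ℕ p) ([q*d]/ℕd≡q p q) ⟨
      q * + p /ℕ p + a /ℕ p    ∎
      where open ≡-Reasoning

    floor-index : ∀ l x → + p ∣ l → (l + ℚ.floor x) /ℕ p ≡ l /ℕ p + ℚ.floor (x ℚ.* (+ 1 ℚ./ p))
    floor-index l x p∣l = trans ([l+a]/ℕp≡l/ℕp+a/ℕp l (ℚ.floor x) p∣l)
      (cong (_+_ (l /ℕ p)) (sym (floor[x*1/n]≡floor[x]/ℕn x p)))

    ceiling-index : ∀ n l x → + p ∣ n → + p ∣ l →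
      (n - l - ℚ.ceiling x) /ℕ p ≡ n /ℕ p - l /ℕ p - ℚ.ceiling (x ℚ.* (+ 1 ℚ./ p))
    ceiling-index n l x p∣n p∣l = begin
      (n - l - ℚ.ceiling x) /ℕ p       ≡⟨ cong (λ c → (n - l - c) /ℕ p) (ceiling≡-floor[-x] x) ⟩
      (n - l - - F) /ℕ p               ≡⟨ cong (_/ℕ p) (unfold n l F) ⟩
      (n - l + F) /ℕ p                 ≡⟨ [l+a]/ℕp≡l/ℕp+a/ℕp (n - l) F p∣n-l ⟩
      (n - l) /ℕ p + F /ℕ p            ≡⟨ cong₂ _+_ [n-l]/p≡ (sym (floor[x*1/n]≡floor[x]/ℕn (ℚ.- x) p)) ⟩
      n /ℕ p - l /ℕ p + ℚ.floor (ℚ.- x ℚ.* w)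
        ≡⟨ cong (λ y → n /ℕ p - l /ℕ p + ℚ.floor y) (ℚP.neg-distribˡ-* x w) ⟨
      n /ℕ p - l /ℕ p + ℚ.floor (ℚ.- (x ℚ.* w))
        ≡⟨ unfold (n /ℕ p) (l /ℕ p) _ ⟨
      n /ℕ p - l /ℕ p - - ℚ.floor (ℚ.- (x ℚ.* w))
        ≡⟨ cong (λ c → n /ℕ p - l /ℕ p - c) (ceiling≡-floor[-x] (x ℚ.* w)) ⟨
      n /ℕ p - l /ℕ p - ℚ.ceiling (x ℚ.* w)
        ∎
      where
      open ≡-Reasoning
      w = + 1 ℚ./ p
      F = ℚ.floor (ℚ.- x)
      p∣n-l = ∣m∣n⇒∣m-n p∣n p∣l
      unfold : ∀ a b c → a - b - - c ≡ a - b + c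
      unfold = solve-∀
      [n-l]/p≡ : (n - l) /ℕ p ≡ n /ℕ p - l /ℕ p
      [n-l]/p≡ = begin
        (n - l) /ℕ p                      ≡⟨ cancel ((n - l) /ℕ p) (l /ℕ p) ⟩
        (n - l) /ℕ p + l /ℕ p - l /ℕ p    ≡⟨ cong (_- l /ℕ p) ([l+a]/ℕp≡l/ℕp+a/ℕp (n - l) l p∣n-l) ⟨
        (n - l + l) /ℕ p - l /ℕ p         ≡⟨ cong (λ y → y /ℕ p - l /ℕ p) (restore n l) ⟩
        n /ℕ p - l /ℕ p                   ∎
        where
        cancel : ∀ a b → a ≡ a + b - b
        cancel = solve-∀
        restore : ∀ n l → n - l + l ≡ n
        restore = solve-∀

  module _ (p : ℕ) .{{_ : NonZero p}} (prime : Prime p) where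

    p∤1 : ¬ p ∣ℕ 1
    p∤1 p∣1 = ℕP.<-irrefl refl (subst (1 ℕ.<_) (ND.∣1⇒≡1 p∣1) 1<p)
      where
      1<p : 1 ℕ.< p
      1<p = ℕ.nonTrivial⇒n>1 p {{prime⇒nonTrivial prime}}

    p^n∣u*x⇒p^n∣x : ∀ n {u x} → ¬ p ∣ℕ u → p ℕ.^ n ∣ℕ u ℕ.* x → p ℕ.^ n ∣ℕ x
    p^n∣u*x⇒p^n∣x zero    {x = x} _   _      = ND.1∣ x
    p^n∣u*x⇒p^n∣x (suc n) {u} {x} p∤u p^n⁺¹∣ux
      with p^n∣u*x⇒p^n∣x n p∤u (ND.∣-trans (ND.n∣m*n p) p^n⁺¹∣ux)
    ... | ND.divides y refl = ND.*-monoˡ-∣ (p ℕ.^ n) p∣y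
      where
      instance _ = ℕP.m^n≢0 p n
      p∣uy : p ∣ℕ u ℕ.* y
      p∣uy = ND.*-cancelʳ-∣ (p ℕ.^ n) (subst (p ℕ.* p ℕ.^ n ∣ℕ_) (sym (ℕP.*-assoc u y (p ℕ.^ n))) p^n⁺¹∣ux)
      p∣y : p ∣ℕ y
      p∣y with euclidsLemma u y prime p∣uy
      ... | inj₁ p∣u = contradiction p∣u p∤u
      ... | inj₂ p∣y = p∣y

    p∤unitFactor : ∀ a → ¬ p ∣ℕ ℤ.∣ unitFactor p a ∣
    p∤unitFactor a with a %ℕ p in a%p≡
    ... | zero  = p∤1
    ... | suc _ = λ p∣a → p∤a (∣ᵤ⇒∣ p∣a)
      where
      p∤a : ¬ + p ∣ a
      p∤a (divides t refl) = ℕP.0≢1+n (trans (sym ([q*d]%ℕd≡0 p t)) a%p≡)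

    p∤unitProduct : ∀ M k → ¬ p ∣ℕ ℤ.∣ unitProduct p M k ∣
    p∤unitProduct M zero    = p∤1
    p∤unitProduct M (suc k) p∣ with euclidsLemma _ _ prime (subst (p ∣ℕ_) (ℤP.abs-* (unitProduct p M k) _) p∣)
    ... | inj₁ p∣U = p∤unitProduct M k p∣U
    ... | inj₂ p∣u = p∤unitFactor (M - + k) p∣u

    module _ (e : ℕ) where

      pᵉ pᵉ⁺¹ : ℕ
      pᵉ   = p ℕ.^ e
      pᵉ⁺¹ = p ℕ.* pᵉ

      open import Relation.Binary.Reasoning.Setoid (mod-setoid pᵉ⁺¹)

      p∣pᵉ⁺¹ : p ∣ℕ pᵉ⁺¹
      p∣pᵉ⁺¹ = ND.m∣m*n pᵉ

      cancel-unit-mod : ∀ u {a b} → ¬ p ∣ℕ ℤ.∣ u ∣ → u * a ≡ u * b mod pᵉ⁺¹ → a ≡ b mod pᵉ⁺¹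
      cancel-unit-mod u {a} {b} p∤u (mod-divides pᵉ⁺¹∣ua-ub) = mod-divides (∣ᵤ⇒∣ {+ pᵉ⁺¹} {a - b}
        (p^n∣u*x⇒p^n∣x (suc e) p∤u (subst (pᵉ⁺¹ ∣ℕ_) (ℤP.abs-* u (a - b))
          (∣⇒∣ᵤ (subst (+ pᵉ⁺¹ ∣_) (factor u a b) pᵉ⁺¹∣ua-ub)))))
        where
        factor : ∀ u a b → u * a - u * b ≡ u * (a - b)
        factor = solve-∀

      unitProduct-shift : ∀ M → unitProduct p M pᵉ⁺¹ ≡ unitProduct p (M - + 1) pᵉ⁺¹ mod pᵉ⁺¹
      unitProduct-shift M = cancel-unit-mod u (p∤unitFactor (M - + 0)) (begin
        u * U                           ≡⟨ ℤP.*-comm u U ⟩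
        U * u                           ≈⟨ *-congˡ-mod U (unitFactor-cong p M≡M-pᵉ⁺¹) ⟩
        unitProduct p M (1 ℕ.+ pᵉ⁺¹)     ≡⟨ unitProduct-+ p M 1 pᵉ⁺¹ ⟩
        + 1 * u * U₁                    ≡⟨ cong (_* U₁) (ℤP.*-identityˡ u) ⟩
        u * U₁                          ∎)
        where
        u = unitFactor p (M - + 0)
        U = unitProduct p M pᵉ⁺¹
        U₁ = unitProduct p (M - + 1) pᵉ⁺¹
        M≡M-pᵉ⁺¹ : M - + 0 ≡ M - + pᵉ⁺¹ mod pᵉ⁺¹
        M≡M-pᵉ⁺¹ = mod-divides (divides (+ 1) (difference M (+ pᵉ⁺¹)))
          where
          difference : ∀ M Q → M - + 0 - (M - Q) ≡ + 1 * Q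
          difference = solve-∀

      unitProduct-shift-by : ∀ t M → unitProduct p M pᵉ⁺¹ ≡ unitProduct p (M - + t) pᵉ⁺¹ mod pᵉ⁺¹
      unitProduct-shift-by zero    M =
        ≡-mod-reflexive (cong (λ N → unitProduct p N pᵉ⁺¹) (sym (ℤP.+-identityʳ M)))
      unitProduct-shift-by (suc t) M = ≡-mod-trans (unitProduct-shift-by t M)
        (subst (λ N → unitProduct p (M - + t) pᵉ⁺¹ ≡ unitProduct p N pᵉ⁺¹ mod pᵉ⁺¹) (step M (+ t))
          (unitProduct-shift (M - + t)))
        where
        step : ∀ M t → M - t - + 1 ≡ M - (+ 1 + t)
        step = solve-∀

      unitProduct-period : ∀ M M′ → unitProduct p M pᵉ⁺¹ ≡ unitProduct p M′ pᵉ⁺¹ mod pᵉ⁺¹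
      unitProduct-period M M′ with M - M′ in M-M′≡
      ... | + t      = subst (λ N → unitProduct p M pᵉ⁺¹ ≡ unitProduct p N pᵉ⁺¹ mod pᵉ⁺¹)
        (trans (cong (_-_ M) (sym M-M′≡)) (cancel M M′)) (unitProduct-shift-by t M)
        where
        cancel : ∀ M M′ → M - (M - M′) ≡ M′
        cancel = solve-∀
      ... | -[1+ t ] = ≡-mod-sym (subst (λ N → unitProduct p M′ pᵉ⁺¹ ≡ unitProduct p N pᵉ⁺¹ mod pᵉ⁺¹)
        (trans (cong (_-_ M′) (sym (cong -_ M-M′≡))) (cancel M M′)) (unitProduct-shift-by (suc t) M′))
        where
        cancel : ∀ M M′ → M′ - - (M - M′) ≡ M
        cancel = solve-∀

      unitProduct-window : ∀ c M M′ →
        unitProduct p M (c ℕ.* pᵉ⁺¹) ≡ unitProduct p M′ (c ℕ.* pᵉ⁺¹) mod pᵉ⁺¹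
      unitProduct-window zero    M M′ = ≡-mod-reflexive refl
      unitProduct-window (suc c) M M′ = begin
        unitProduct p M (pᵉ⁺¹ ℕ.+ c ℕ.* pᵉ⁺¹)
          ≡⟨ unitProduct-+ p M pᵉ⁺¹ _ ⟩
        unitProduct p M pᵉ⁺¹ * unitProduct p (M - + pᵉ⁺¹) (c ℕ.* pᵉ⁺¹)
          ≈⟨ *-cong-mod (unitProduct-period M M′) (unitProduct-window c _ _) ⟩
        unitProduct p M′ pᵉ⁺¹ * unitProduct p (M′ - + pᵉ⁺¹) (c ℕ.* pᵉ⁺¹)
          ≡⟨ unitProduct-+ p M′ pᵉ⁺¹ _ ⟨
        unitProduct p M′ (pᵉ⁺¹ ℕ.+ c ℕ.* pᵉ⁺¹)
          ∎

      binom-cross-mod : ∀ M M′ k → unitProduct p M k ≡ unitProduct p M′ k mod pᵉ⁺¹ →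
        #multiples p M k ≡ #multiples p M′ k → let c = #multiples p M k in
        binom M (+ k) * binom (M′ /ℕ p) (+ c) ≡ binom M′ (+ k) * binom (M /ℕ p) (+ c) mod pᵉ⁺¹
      binom-cross-mod M M′ k U≡U′ c≡c′ = cancel-unit-mod U (p∤unitProduct M k) (begin
        U * (B * b′)    ≈⟨ *-congʳ-mod (B * b′) U≡U′ ⟩
        U′ * (B * b′)   ≡⟨ ℤP.*-assoc U′ B b′ ⟨
        U′ * B * b′     ≡⟨ binom-cross p M M′ k c≡c′ ⟩
        U * B′ * b      ≡⟨ ℤP.*-assoc U B′ b ⟩
        U * (B′ * b)    ∎)
        where
        c = #multiples p M k
        U = unitProduct p M k
        U′ = unitProduct p M′ k
        B = binom M (+ k)
        B′ = binom M′ (+ k)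
        b = binom (M /ℕ p) (+ c)
        b′ = binom (M′ /ℕ p) (+ c)

      binom≡ε*binom[M/p,k/p] : ∀ M k → unitProduct p M k ≡ unitProduct p -1ℤ k mod pᵉ⁺¹ →
        #multiples p M k ≡ k ℕ./ p → binom M (+ k) ≡ ε p k * binom (M /ℕ p) (+ (k ℕ./ p)) mod pᵉ⁺¹
      binom≡ε*binom[M/p,k/p] M k U≡U₋₁ c≡k/p = begin
        B                         ≡⟨ ℤP.*-identityʳ B ⟨
        B * + 1                   ≡⟨ cong (B *_) (-1^n*-1^n≡1 c) ⟨
        B * (-1ℤ ^ c * -1ℤ ^ c)   ≡⟨ ℤP.*-assoc B _ _ ⟨
        B * -1ℤ ^ c * -1ℤ ^ c     ≈⟨ *-congʳ-mod (-1ℤ ^ c) cross ⟩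
        -1ℤ ^ k * b * -1ℤ ^ c     ≡⟨ regroup (-1ℤ ^ k) b (-1ℤ ^ c) ⟩
        -1ℤ ^ k * -1ℤ ^ c * b     ≡⟨ cong (_* b) (ℤP.^-distribˡ-+-* -1ℤ k c) ⟨
        ε p k * b                 ∎
        where
        c = k ℕ./ p
        B = binom M (+ k)
        b = binom (M /ℕ p) (+ c)
        cross : B * -1ℤ ^ c ≡ -1ℤ ^ k * b mod pᵉ⁺¹
        cross = subst₂ (λ x y → B * x ≡ y * b mod pᵉ⁺¹)
          (trans (cong (λ N → binom N (+ c)) (-1/ℕp≡-1 p)) (binom[-1,k]≡-1^k c)) (binom[-1,k]≡-1^k k)
          (subst (λ c → B * binom (-1ℤ /ℕ p) (+ c) ≡ binom -1ℤ (+ k) * binom (M /ℕ p) (+ c) mod pᵉ⁺¹) c≡k/p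
            (binom-cross-mod M -1ℤ k U≡U₋₁ (trans c≡k/p (sym (#multiples[-1,k]≡k/p p k)))))
        regroup : ∀ s b t → s * b * t ≡ s * t * b
        regroup = solve-∀

      εpᵉ⁺¹≡1 : ε p pᵉ⁺¹ ≡ + 1 mod pᵉ⁺¹
      εpᵉ⁺¹≡1 = begin
        ε p pᵉ⁺¹                    ≡⟨ ℤP.*-identityʳ _ ⟨
        ε p pᵉ⁺¹ * + 1              ≡⟨ cong (ε p pᵉ⁺¹ *_) (binom[n,n]≡1 (pᵉ⁺¹ ℕ./ p)) ⟨
        ε p pᵉ⁺¹ * binom (+ (pᵉ⁺¹ ℕ./ p)) (+ (pᵉ⁺¹ ℕ./ p))
          ≈⟨ binom≡ε*binom[M/p,k/p] (+ pᵉ⁺¹) pᵉ⁺¹ (unitProduct-period _ _)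
               (#multiples-of-multiple p _ pᵉ⁺¹ p∣pᵉ⁺¹) ⟨
        binom (+ pᵉ⁺¹) (+ pᵉ⁺¹)     ≡⟨ binom[n,n]≡1 pᵉ⁺¹ ⟩
        + 1                         ∎

      ε-multiple≡1 : ∀ j → ε p (j ℕ.* pᵉ⁺¹) ≡ + 1 mod pᵉ⁺¹
      ε-multiple≡1 zero    = ≡-mod-reflexive (ε0≡1 p)
      ε-multiple≡1 (suc j) = begin
        ε p (pᵉ⁺¹ ℕ.+ j ℕ.* pᵉ⁺¹)      ≡⟨ ε-+ p pᵉ⁺¹ (ND.∣n⇒∣m*n j p∣pᵉ⁺¹) ⟩
        ε p pᵉ⁺¹ * ε p (j ℕ.* pᵉ⁺¹)    ≈⟨ *-cong-mod εpᵉ⁺¹≡1 (ε-multiple≡1 j) ⟩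
        + 1                            ∎

      ε-periodic : ∀ k j → ε p (k ℕ.+ j ℕ.* pᵉ⁺¹) ≡ ε p k mod pᵉ⁺¹
      ε-periodic k j = begin
        ε p (k ℕ.+ j ℕ.* pᵉ⁺¹)      ≡⟨ ε-+ p k (ND.∣n⇒∣m*n j p∣pᵉ⁺¹) ⟩
        ε p k * ε p (j ℕ.* pᵉ⁺¹)    ≈⟨ *-congˡ-mod (ε p k) (ε-multiple≡1 j) ⟩
        ε p k * + 1                 ≡⟨ ℤP.*-identityʳ (ε p k) ⟩
        ε p k                       ∎

      ε-cong : ∀ k k′ → + pᵉ⁺¹ ∣ + k′ - + k → ε p k′ ≡ ε p k mod pᵉ⁺¹
      ε-cong k k′ (divides (+ j) k′-k≡) = subst (λ x → ε p x ≡ ε p k mod pᵉ⁺¹)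
        (sym (+k′-+k≡j*m⇒k′≡k+j*m k k′ j pᵉ⁺¹ k′-k≡)) (ε-periodic k j)
      ε-cong k k′ (divides -[1+ j ] k′-k≡) = ≡-mod-sym (subst (λ x → ε p x ≡ ε p k′ mod pᵉ⁺¹)
        (sym (+k′-+k≡j*m⇒k′≡k+j*m k′ k (suc j) pᵉ⁺¹ k-k′≡)) (ε-periodic k′ (suc j)))
        where
        k-k′≡ : + k - + k′ ≡ + suc j * + pᵉ⁺¹
        k-k′≡ = trans (negate (+ k) (+ k′)) (trans (cong -_ k′-k≡) (ℤP.neg-distribˡ-* -[1+ j ] (+ pᵉ⁺¹)))
          where
          negate : ∀ a b → a - b ≡ - (b - a)
          negate = solve-∀

      binom[M,n]≡binom[M/p,n/p] : ∀ M n → pᵉ⁺¹ ∣ℕ n →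
        binom M (+ n) ≡ binom (M /ℕ p) (+ (n ℕ./ p)) mod pᵉ⁺¹
      binom[M,n]≡binom[M/p,n/p] M .(c ℕ.* pᵉ⁺¹) (ND.divides c refl) = begin
        binom M (+ (c ℕ.* pᵉ⁺¹))
          ≈⟨ binom≡ε*binom[M/p,k/p] M (c ℕ.* pᵉ⁺¹) (unitProduct-window c M -1ℤ)
               (#multiples-of-multiple p M _ (ND.∣n⇒∣m*n c p∣pᵉ⁺¹)) ⟩
        ε p (c ℕ.* pᵉ⁺¹) * b     ≈⟨ *-congʳ-mod b (ε-multiple≡1 c) ⟩
        + 1 * b                  ≡⟨ ℤP.*-identityˡ b ⟩
        b                        ∎
        where
        b = binom (M /ℕ p) (+ (c ℕ.* pᵉ⁺¹ ℕ./ p))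

      binom[M,l]≡binom[M/p,l/p] : ∀ M l → + pᵉ⁺¹ ∣ l →
        binom M l ≡ binom (M /ℕ p) (l /ℕ p) mod pᵉ⁺¹
      binom[M,l]≡binom[M/p,l/p] M (+ n)    pᵉ⁺¹∣l = binom[M,n]≡binom[M/p,n/p] M n (∣⇒∣ᵤ pᵉ⁺¹∣l)
      binom[M,l]≡binom[M/p,l/p] M -[1+ n ] _ with /ℕ-negative p n
      ... | _ , l/p≡ rewrite l/p≡ = ≡-mod-reflexive refl

      binom[n-1,k]≡ε*binom[n/p-1,k/p] : ∀ n k → + pᵉ⁺¹ ∣ n →
        binom (n - + 1) (+ k) ≡ ε p k * binom (n /ℕ p - + 1) (+ (k ℕ./ p)) mod pᵉ⁺¹
      binom[n-1,k]≡ε*binom[n/p-1,k/p] n k (divides t n≡) =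
        subst (λ N → binom (n - + 1) (+ k) ≡ ε p k * binom N (+ (k ℕ./ p)) mod pᵉ⁺¹)
          ([a-1]/ℕd≡a/ℕd-1 p n n%p≡0)
          (binom≡ε*binom[M/p,k/p] (n - + 1) k (unitProduct-cong p k n-1≡-1)
            (trans (#multiples-cong p k n-1≡-1) (#multiples[-1,k]≡k/p p k)))
        where
        n-1≡-1 : n - + 1 ≡ -1ℤ mod pᵉ⁺¹
        n-1≡-1 = mod-divides (divides t (trans (cancel n) n≡))
          where
          cancel : ∀ n → n - + 1 - -1ℤ ≡ n
          cancel = solve-∀
        n%p≡0 : n %ℕ p ≡ 0
        n%p≡0 = trans (cong (_%ℕ p) (trans n≡ (trans (cong (t *_) (ℤP.pos-* p pᵉ)) (regroup t (+ p) (+ pᵉ)))))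
          ([q*d]%ℕd≡0 p (t * + pᵉ))
          where
          regroup : ∀ t p q → t * (p * q) ≡ t * q * p
          regroup = solve-∀

      binom-pred-pair : ∀ n u v → + pᵉ⁺¹ ∣ n → + pᵉ⁺¹ ∣ v - u →
        binom (n - + 1) u * binom (n - + 1) v ≡
        binom (n /ℕ p - + 1) (u /ℕ p) * binom (n /ℕ p - + 1) (v /ℕ p) mod pᵉ⁺¹
      binom-pred-pair n -[1+ i ] v _ _ with /ℕ-negative p i
      ... | _ , u/p≡ rewrite u/p≡ = ≡-mod-reflexive refl
      binom-pred-pair n (+ k) -[1+ i ] _ _ with /ℕ-negative p i
      ... | _ , v/p≡ rewrite v/p≡ = ≡-mod-reflexive
        (trans (ℤP.*-zeroʳ (binom (n - + 1) (+ k))) (sym (ℤP.*-zeroʳ (binom (n /ℕ p - + 1) (+ k /ℕ p)))))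
      binom-pred-pair n (+ k) (+ k′) pᵉ⁺¹∣n pᵉ⁺¹∣k′-k = begin
        binom (n - + 1) (+ k) * binom (n - + 1) (+ k′)
          ≈⟨ *-cong-mod (binom[n-1,k]≡ε*binom[n/p-1,k/p] n k pᵉ⁺¹∣n)
                        (binom[n-1,k]≡ε*binom[n/p-1,k/p] n k′ pᵉ⁺¹∣n) ⟩
        ε p k * b * (ε p k′ * b′)
          ≈⟨ *-congˡ-mod (ε p k * b) (*-congʳ-mod b′ (ε-cong k k′ pᵉ⁺¹∣k′-k)) ⟩
        ε p k * b * (ε p k * b′)     ≡⟨ regroup (ε p k) b b′ ⟩
        ε p k * ε p k * (b * b′)     ≡⟨ cong (_* (b * b′)) (-1^n*-1^n≡1 (k ℕ.+ k ℕ./ p)) ⟩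
        + 1 * (b * b′)               ≡⟨ ℤP.*-identityˡ (b * b′) ⟩
        b * b′                       ∎
        where
        b = binom (n /ℕ p - + 1) (+ (k ℕ./ p))
        b′ = binom (n /ℕ p - + 1) (+ (k′ ℕ./ p))
        regroup : ∀ s b b′ → s * b * (s * b′) ≡ s * s * (b * b′)
        regroup = solve-∀

      C≡C[ℓ/p,n/p,x/p] : ∀ ℓ n x → All (+ pᵉ⁺¹ ∣_) ℓ → + pᵉ⁺¹ ∣ n →
        C ℓ n x ≡ C (map (_/ℕ p) ℓ) (n /ℕ p) (x ℚ.* (+ 1 ℚ./ p)) mod pᵉ⁺¹
      C≡C[ℓ/p,n/p,x/p] ℓ@(l₁ ∷ _ ∷ l₃ ∷ l₄ ∷ _ ∷ l₆ ∷ _) n x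
        (pᵉ⁺¹∣l₁ ∷ _ ∷ pᵉ⁺¹∣l₃ ∷ pᵉ⁺¹∣l₄ ∷ _ ∷ pᵉ⁺¹∣l₆ ∷ _) pᵉ⁺¹∣n = begin
        B₁ * B₂ * B₃ * B₄
          ≡⟨ regroup B₁ B₂ B₃ B₄ ⟩
        B₁ * B₃ * (B₂ * B₄)
          ≈⟨ *-cong-mod (binom-pred-pair n (l₁ + F) (l₆ + F) pᵉ⁺¹∣n pᵉ⁺¹∣l₆-l₁)
                        (*-cong-mod (binom[M,l]≡binom[M/p,l/p] _ l₃ pᵉ⁺¹∣l₃)
                                    (binom[M,l]≡binom[M/p,l/p] _ l₄ pᵉ⁺¹∣l₄)) ⟩
        b₁ * b₃ * (b₂ * b₄)
          ≡⟨ regroup b₁ b₂ b₃ b₄ ⟨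
        b₁ * b₂ * b₃ * b₄
          ≡⟨ cong₂ _*_ (cong₂ _*_ (cong₂ _*_ (lower-index l₁ pᵉ⁺¹∣l₁) (upper-index l₁ l₃ pᵉ⁺¹∣l₁))
                                  (lower-index l₆ pᵉ⁺¹∣l₆))
                       (upper-index l₆ l₄ pᵉ⁺¹∣l₆) ⟩
        C (map (_/ℕ p) ℓ) (n /ℕ p) (x ℚ.* w)
          ∎
        where
        w = + 1 ℚ./ p
        F = ℚ.floor x
        B₁ = binom (n - + 1) (l₁ + F)
        B₂ = binom (n - l₁ - ℚ.ceiling x) l₃
        B₃ = binom (n - + 1) (l₆ + F)
        B₄ = binom (n - l₆ - ℚ.ceiling x) l₄
        b₁ = binom (n /ℕ p - + 1) ((l₁ + F) /ℕ p)
        b₂ = binom ((n - l₁ - ℚ.ceiling x) /ℕ p) (l₃ /ℕ p)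
        b₃ = binom (n /ℕ p - + 1) ((l₆ + F) /ℕ p)
        b₄ = binom ((n - l₆ - ℚ.ceiling x) /ℕ p) (l₄ /ℕ p)
        regroup : ∀ a b c d → a * b * c * d ≡ a * c * (b * d)
        regroup = solve-∀
        pᵉ⁺¹∣l₆-l₁ : + pᵉ⁺¹ ∣ (l₆ + F) - (l₁ + F)
        pᵉ⁺¹∣l₆-l₁ = subst (+ pᵉ⁺¹ ∣_) (shift l₆ l₁ F) (∣m∣n⇒∣m-n pᵉ⁺¹∣l₆ pᵉ⁺¹∣l₁)
          where
          shift : ∀ a b f → a - b ≡ (a + f) - (b + f)
          shift = solve-∀
        p∣ : ∀ {l} → + pᵉ⁺¹ ∣ l → + p ∣ l
        p∣ = ∣-trans (∣ᵤ⇒∣ p∣pᵉ⁺¹)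
        lower-index : ∀ l → + pᵉ⁺¹ ∣ l →
          binom (n /ℕ p - + 1) ((l + F) /ℕ p) ≡ binom (n /ℕ p - + 1) (l /ℕ p + ℚ.floor (x ℚ.* w))
        lower-index l pᵉ⁺¹∣l = cong (binom (n /ℕ p - + 1)) (floor-index p l x (p∣ pᵉ⁺¹∣l))
        upper-index : ∀ l l′ → + pᵉ⁺¹ ∣ l →
          binom ((n - l - ℚ.ceiling x) /ℕ p) (l′ /ℕ p) ≡
          binom (n /ℕ p - l /ℕ p - ℚ.ceiling (x ℚ.* w)) (l′ /ℕ p)
        upper-index l l′ pᵉ⁺¹∣l =
          cong (λ N → binom N (l′ /ℕ p)) (ceiling-index p n l x (p∣ pᵉ⁺¹∣n) (p∣ pᵉ⁺¹∣l))

open import Defs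
open import Data.Nat using (ℕ; zero; suc; _^_; _≥_; NonZero)
open import Data.Nat.Primality using (Prime)
open import Data.Integer using (ℤ; +_; _-_; _/ℕ_)
open import Data.Integer.Divisibility using (_∣_)
open import Data.Integer.Divisibility.Signed using (∣ᵤ⇒∣; ∣⇒∣ᵤ)
open import Data.Rational using (ℚ; 0ℚ; _≤_; _*_; _/_)
open import Data.Vec using (Vec; map)
open import Data.Vec.Relation.Unary.All using (All)
import Data.Vec.Relation.Unary.All as All
open BinomialCongruences using (module _≡_mod_; C≡C[ℓ/p,n/p,x/p])

lemma2p7 : (p s : ℕ) → .{{_ : NonZero p}} → Prime p → s ≥ 1 →
           (ℓ : Vec ℤ 12) → (n : ℤ) → (x : ℚ) →
           All (λ l → (+ (p ^ s)) ∣ l) ℓ → (+ (p ^ s)) ∣ n →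
           0ℚ ≤ x → x ≤ (+ (p ^ s)) / 1 →
           (+ (p ^ s)) ∣ (C ℓ n x - C (map (λ l → l /ℕ p) ℓ) (n /ℕ p) (x * ((+ 1) / p)))
lemma2p7 p zero    _       ()
lemma2p7 p (suc e) prime-p _ ℓ n x pˢ∣ℓ pˢ∣n _ _ =
  ∣⇒∣ᵤ (_≡_mod_.m∣a-b
    (C≡C[ℓ/p,n/p,x/p] p prime-p e ℓ n x (All.map ∣ᵤ⇒∣ pˢ∣ℓ) (∣ᵤ⇒∣ pˢ∣n)))
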